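{- Let $n \equiv 1$ or $5 \pmod 6$ and $g \in \mathbb{Z}_n$. For $h\in\mathbb{Z}_n$ let $D_h'$ be the directed graph with vertex set $\mathbb{Z}_n=\{0,\ldots,n-1\}$ having an arc from $i+h$ to $-2i+h$ for each $i \in \mathbb{Z}_n$ (arithmetic mod $n$). Then the directed graph $D_g' \cup D_{g+1}'$ (same vertex set, union of the arc sets) is strongly connected.
   Context: A directed graph is strongly connected if for every ordered pair of vertices $x,y$ there is a directed path from $x$ to $y$. -}

module Defs where

open import Data.Nat using (ℕ; _+_; _*_; _∸_; _%_; NonZero)
open import Data.Nat.DivMod using (m%n<n)
open import Data.Fin using (Fin; toℕ; fromℕ<)
open import Data.Product using (∃-syntax; _×_)
open import Data.Sum using (_⊎_)
open import Relation.Binary.PropositionalEquality using (_≡_)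
open import Relation.Binary.Construct.Closure.ReflexiveTransitive using (Star)

module ZMod (n : ℕ) .{{_ : NonZero n}} where

  [_] : ℕ → Fin n
  [ m ] = fromℕ< (m%n<n m n)

  _⊕_ : Fin n → Fin n → Fin n
  a ⊕ b = [ toℕ a + toℕ b ]

  ⊖_ : Fin n → Fin n
  ⊖ a = [ n ∸ toℕ a ]

  neg2· : Fin n → Fin n
  neg2· a = [ 2 * (n ∸ toℕ a) ]

  one : Fin n
  one = [ 1 ]

  D′ : Fin n → Fin n → Fin n → Set
  D′ h x y = ∃[ i ] (x ≡ i ⊕ h × y ≡ neg2· i ⊕ h)

  D′∪ : Fin n → Fin n → Fin n → Set
  D′∪ g x y = D′ g x y ⊎ D′ (g ⊕ one) x y

StronglyConnected : {V : Set} → (V → V → Set) → Set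
StronglyConnected {V} E = (x y : V) → Star E x y

-- In D′_h the vertex x has the single out-arc x → 3h − 2x, and since 2 is invertible modulo n
-- this is a permutation of ℤ_n. Following the cycle of D′_g through z, every vertex z reaches
-- its D′_g-preimage w, and the D′_{g+1}-arc out of w ends at z + 3. As 3 is invertible modulo n,
-- repeated translation by 3 reaches every vertex.
module Submission where

open import Defs
open import Data.Fin using (Fin; toℕ)
open import Data.Fin.Properties using (pigeonhole; toℕ-fromℕ<; toℕ-injective; toℕ<n)
open import Data.Integer using (ℤ; +_; -[1+_]; _+_; _-_; _*_; -_; 0ℤ; 1ℤ)
open import Data.Integer.Properties using (pos-+; pos-*; +-injective; m-n≡m⊖n; ⊖-≥; *-identityʳ; neg-involutive)
open import Data.Integer.Tactic.RingSolver using (solve-∀)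
open import Data.Nat as ℕ using (ℕ; zero; suc; NonZero; _%_)
open import Data.Nat.DivMod using (m≡m%n+[m/n]*n; m%n<n; [m+kn]%n≡m%n; m<n⇒m%n≡m)
open import Data.Nat.GeneralisedArithmetic using (iterate)
import Data.Nat.Properties as ℕ
import Data.Nat.Tactic.RingSolver as ℕ-Solver
open import Data.Product using (∃-syntax; _×_; _,_)
open import Data.Sum using (_⊎_; inj₁; inj₂)
open import Function.Definitions using (Injective)
open import Level using (0ℓ)
open import Relation.Binary.Bundles using (Setoid)
import Relation.Binary.Reasoning.Setoid as SetoidReasoning
open import Relation.Binary.Construct.Closure.ReflexiveTransitive using (Star; ε; _◅_; _◅◅_)
open import Relation.Binary.PropositionalEquality hiding ([_])
open import Relation.Binary.Structures using (IsEquivalence)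

module _ {A : Set} (f : A → A) where

  iterate-suc : ∀ x m → iterate f x (suc m) ≡ f (iterate f x m)
  iterate-suc x zero    = refl
  iterate-suc x (suc m) = iterate-suc (f x) m

  iterate-+ : ∀ x m k → iterate f x (m ℕ.+ k) ≡ iterate f (iterate f x m) k
  iterate-+ x zero    k = refl
  iterate-+ x (suc m) k = iterate-+ (f x) m k

  iterate-injective : Injective _≡_ _≡_ f → ∀ m → Injective _≡_ _≡_ (λ x → iterate f x m)
  iterate-injective f-inj zero    eq = eq
  iterate-injective f-inj (suc m) eq = f-inj (iterate-injective f-inj m eq)

  Star-iterate : {E : A → A → Set} → (∀ x → Star E x (f x)) → ∀ x m → Star E x (iterate f x m)
  Star-iterate step x zero    = ε
  Star-iterate step x (suc m) = step x ◅◅ Star-iterate step (f x) m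

iterate-periodic : ∀ {n} (f : Fin n → Fin n) → Injective _≡_ _≡_ f →
                   ∀ z → ∃[ k ] iterate f z (suc k) ≡ z
iterate-periodic {n} f f-inj z
  with i , j , i<j , fⁱz≡fʲz ← pigeonhole (ℕ.n<1+n n) (λ i → iterate f z (toℕ i))
  with k , i+1+k≡j ← ℕ.m≤n⇒∃[o]m+o≡n i<j
  = k , sym (iterate-injective f f-inj (toℕ i) (begin
      iterate f z (toℕ i)                      ≡⟨ fⁱz≡fʲz ⟩
      iterate f z (toℕ j)                      ≡⟨ cong (iterate f z) j≡1+k+i ⟩
      iterate f z (suc k ℕ.+ toℕ i)            ≡⟨ iterate-+ f z (suc k) (toℕ i) ⟩
      iterate f (iterate f z (suc k)) (toℕ i)  ∎))
  where
  open ≡-Reasoning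
  j≡1+k+i : toℕ j ≡ suc k ℕ.+ toℕ i
  j≡1+k+i = trans (sym i+1+k≡j) (cong suc (ℕ.+-comm (toℕ i) k))

Star-preimage : ∀ {n} {E : Fin n → Fin n → Set} (f : Fin n → Fin n) → Injective _≡_ _≡_ f →
                (∀ x → E x (f x)) → ∀ z → ∃[ w ] Star E z w × f w ≡ z
Star-preimage f f-inj arc z with k , fᵏ⁺¹z≡z ← iterate-periodic f f-inj z =
  iterate f z k , Star-iterate f (λ x → arc x ◅ ε) z k , trans (sym (iterate-suc f z k)) fᵏ⁺¹z≡z

module Congruence (N : ℤ) where

  infix 4 _≋_
  data _≋_ (a b : ℤ) : Set where
    _,_ : (k : ℤ) → a ≡ b + k * N → a ≋ b

  +-multiple≋ : ∀ a k → a + k * N ≋ a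
  +-multiple≋ a k = k , refl

  ≋-reflexive : ∀ {a b} → a ≡ b → a ≋ b
  ≋-reflexive {a} refl = 0ℤ , identity a N
    where identity : ∀ a N → a ≡ a + 0ℤ * N
          identity = solve-∀

  ≋-refl : ∀ {a} → a ≋ a
  ≋-refl = ≋-reflexive refl

  ≋-sym : ∀ {a b} → a ≋ b → b ≋ a
  ≋-sym {b = b} (k , refl) = - k , identity b k N
    where identity : ∀ b k N → b ≡ (b + k * N) + (- k) * N
          identity = solve-∀

  ≋-trans : ∀ {a b c} → a ≋ b → b ≋ c → a ≋ c
  ≋-trans {c = c} (k , refl) (l , refl) = l + k , identity c l k N
    where identity : ∀ c l k N → (c + l * N) + k * N ≡ c + (l + k) * N
          identity = solve-∀

  ≋-isEquivalence : IsEquivalence _≋_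
  ≋-isEquivalence = record { refl = ≋-refl ; sym = ≋-sym ; trans = ≋-trans }

  ≋-setoid : Setoid 0ℓ 0ℓ
  ≋-setoid = record { isEquivalence = ≋-isEquivalence }

  ≋-by-nonneg-multiple : ∀ {a b} → a ≋ b → (∃[ k ] a ≡ b + + k * N) ⊎ (∃[ k ] b ≡ a + + k * N)
  ≋-by-nonneg-multiple (+ k , eq) = inj₁ (k , eq)
  ≋-by-nonneg-multiple {b = b} (-[1+ k ] , refl) = inj₂ (suc k , identity b (+ suc k) N)
    where identity : ∀ b k N → b ≡ (b + - k * N) + k * N
          identity = solve-∀

  +-cong : ∀ {a b c d} → a ≋ b → c ≋ d → a + c ≋ b + d
  +-cong {b = b} {d = d} (k , refl) (l , refl) = k + l , identity b d k l N
    where identity : ∀ b d k l N → (b + k * N) + (d + l * N) ≡ (b + d) + (k + l) * N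
          identity = solve-∀

  +-congˡ : ∀ a {b c} → b ≋ c → a + b ≋ a + c
  +-congˡ a = +-cong (≋-refl {a})

  +-congʳ : ∀ a {b c} → b ≋ c → b + a ≋ c + a
  +-congʳ a b≋c = +-cong b≋c (≋-refl {a})

  *-congˡ : ∀ c {a b} → a ≋ b → c * a ≋ c * b
  *-congˡ c {b = b} (k , refl) = c * k , identity c b k N
    where identity : ∀ c b k N → c * (b + k * N) ≡ c * b + (c * k) * N
          identity = solve-∀

  *-congʳ : ∀ c {a b} → a ≋ b → a * c ≋ b * c
  *-congʳ c {b = b} (k , refl) = k * c , identity c b k N
    where identity : ∀ c b k N → (b + k * N) * c ≡ b * c + (k * c) * N
          identity = solve-∀

  -‿cong : ∀ {a b} → a ≋ b → - a ≋ - b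
  -‿cong {b = b} (k , refl) = - k , identity b k N
    where identity : ∀ b k N → - (b + k * N) ≡ - b + (- k) * N
          identity = solve-∀

  +-cancelˡ : ∀ c {a b} → c + a ≋ c + b → a ≋ b
  +-cancelˡ c {a} {b} c+a≋c+b = begin
    a              ≡⟨ identity c a ⟩
    - c + (c + a)  ≈⟨ +-congˡ (- c) c+a≋c+b ⟩
    - c + (c + b)  ≡⟨ identity c b ⟨
    b              ∎
    where
    open SetoidReasoning ≋-setoid
    identity : ∀ c a → a ≡ - c + (c + a)
    identity = solve-∀

  Unit : ℤ → Set
  Unit a = ∃[ u ] a * u ≋ 1ℤ

  Unit-resp-≋ : ∀ {a b} → a ≋ b → Unit a → Unit b
  Unit-resp-≋ a≋b (u , au≋1) = u , ≋-trans (*-congʳ u (≋-sym a≋b)) au≋1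

  Unit-cancelˡ : ∀ {a x y} → Unit a → a * x ≋ a * y → x ≋ y
  Unit-cancelˡ {a} {x} {y} (u , au≋1) ax≋ay = begin
    x            ≡⟨ *-identityʳ x ⟨
    x * 1ℤ       ≈⟨ *-congˡ x au≋1 ⟨
    x * (a * u)  ≡⟨ reassoc a u x ⟩
    u * (a * x)  ≈⟨ *-congˡ u ax≋ay ⟩
    u * (a * y)  ≡⟨ reassoc a u y ⟨
    y * (a * u)  ≈⟨ *-congˡ y au≋1 ⟩
    y * 1ℤ       ≡⟨ *-identityʳ y ⟩
    y            ∎
    where
    open SetoidReasoning ≋-setoid
    reassoc : ∀ a u x → x * (a * u) ≡ u * (a * x)
    reassoc = solve-∀

Fin-+-multiple : ∀ {n} .{{_ : NonZero n}} {a b : Fin n} k → toℕ a ≡ toℕ b ℕ.+ k ℕ.* n → a ≡ b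
Fin-+-multiple {n} {a} {b} k eq = toℕ-injective (begin
    toℕ a                      ≡⟨ m<n⇒m%n≡m (toℕ<n a) ⟨
    toℕ a % n                  ≡⟨ cong (_% n) eq ⟩
    (toℕ b ℕ.+ k ℕ.* n) % n    ≡⟨ [m+kn]%n≡m%n (toℕ b) k n ⟩
    toℕ b % n                  ≡⟨ m<n⇒m%n≡m (toℕ<n b) ⟩
    toℕ b                      ∎)
  where open ≡-Reasoning

module Residues (n : ℕ) .{{_ : NonZero n}} where
  open ZMod n
  open Congruence (+ n)
  open SetoidReasoning ≋-setoid

  ⟦_⟧ : Fin n → ℤ
  ⟦ x ⟧ = + toℕ x

  pos-+-multiple : ∀ b k → + (b ℕ.+ k ℕ.* n) ≡ + b + + k * + n
  pos-+-multiple b k = trans (pos-+ b (k ℕ.* n)) (cong (_+_ (+ b)) (pos-* k n))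

  pos-n∸ : ∀ a → + (n ℕ.∸ toℕ a) ≡ + n - ⟦ a ⟧
  pos-n∸ a = sym (trans (m-n≡m⊖n n (toℕ a)) (⊖-≥ (ℕ.<⇒≤ (toℕ<n a))))

  ⟦[]⟧ : ∀ m → ⟦ [ m ] ⟧ ≋ + m
  ⟦[]⟧ m rewrite toℕ-fromℕ< (m%n<n m n) =
    ≋-sym (+ (m ℕ./ n) , trans (cong +_ (m≡m%n+[m/n]*n m n))
                               (pos-+-multiple (m % n) (m ℕ./ n)))

  ⟦⊕⟧ : ∀ a b → ⟦ a ⊕ b ⟧ ≋ ⟦ a ⟧ + ⟦ b ⟧
  ⟦⊕⟧ a b = ≋-trans (⟦[]⟧ (toℕ a ℕ.+ toℕ b)) (≋-reflexive (pos-+ (toℕ a) (toℕ b)))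

  ⟦⊖⟧ : ∀ a → ⟦ ⊖ a ⟧ ≋ - ⟦ a ⟧
  ⟦⊖⟧ a = begin
    ⟦ ⊖ a ⟧             ≈⟨ ⟦[]⟧ (n ℕ.∸ toℕ a) ⟩
    + (n ℕ.∸ toℕ a)     ≡⟨ pos-n∸ a ⟩
    + n - ⟦ a ⟧         ≡⟨ regroup ⟦ a ⟧ (+ n) ⟩
    - ⟦ a ⟧ + 1ℤ * + n  ≈⟨ +-multiple≋ (- ⟦ a ⟧) 1ℤ ⟩
    - ⟦ a ⟧             ∎
    where regroup : ∀ a N → N - a ≡ - a + 1ℤ * N
          regroup = solve-∀

  ⟦neg2·⟧ : ∀ a → ⟦ neg2· a ⟧ ≋ - (+ 2 * ⟦ a ⟧)
  ⟦neg2·⟧ a = begin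
    ⟦ neg2· a ⟧                  ≈⟨ ⟦[]⟧ (2 ℕ.* (n ℕ.∸ toℕ a)) ⟩
    + (2 ℕ.* (n ℕ.∸ toℕ a))      ≡⟨ pos-* 2 (n ℕ.∸ toℕ a) ⟩
    + 2 * + (n ℕ.∸ toℕ a)        ≡⟨ cong (_*_ (+ 2)) (pos-n∸ a) ⟩
    + 2 * (+ n - ⟦ a ⟧)          ≡⟨ regroup ⟦ a ⟧ (+ n) ⟩
    - (+ 2 * ⟦ a ⟧) + + 2 * + n  ≈⟨ +-multiple≋ (- (+ 2 * ⟦ a ⟧)) (+ 2) ⟩
    - (+ 2 * ⟦ a ⟧)              ∎
    where regroup : ∀ a N → + 2 * (N - a) ≡ - (+ 2 * a) + + 2 * N
          regroup = solve-∀

  ⟦⊕⊖⟧ : ∀ a b → ⟦ a ⊕ (⊖ b) ⟧ ≋ ⟦ a ⟧ - ⟦ b ⟧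
  ⟦⊕⊖⟧ a b = ≋-trans (⟦⊕⟧ a (⊖ b)) (+-congˡ ⟦ a ⟧ (⟦⊖⟧ b))

  ⟦⊕one⟧ : ∀ a → ⟦ a ⊕ one ⟧ ≋ ⟦ a ⟧ + 1ℤ
  ⟦⊕one⟧ a = ≋-trans (⟦⊕⟧ a one) (+-congˡ ⟦ a ⟧ (⟦[]⟧ 1))

  ⟦⟧-injective : ∀ {a b} → ⟦ a ⟧ ≋ ⟦ b ⟧ → a ≡ b
  ⟦⟧-injective a≋b with ≋-by-nonneg-multiple a≋b
  ... | inj₁ (k , eq) = Fin-+-multiple k (+-injective (trans eq (sym (pos-+-multiple _ k))))
  ... | inj₂ (k , eq) = sym (Fin-+-multiple k (+-injective (trans eq (sym (pos-+-multiple _ k)))))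

  ⟦⟧-surjective : ∀ a → ∃[ x ] ⟦ x ⟧ ≋ a
  ⟦⟧-surjective (+ m)    = [ m ] , ⟦[]⟧ m
  ⟦⟧-surjective -[1+ m ] = ⊖ [ suc m ] , ≋-trans (⟦⊖⟧ [ suc m ]) (-‿cong (⟦[]⟧ (suc m)))

  iterate-⊕ : ∀ c z m → ⟦ iterate (_⊕ c) z m ⟧ ≋ ⟦ z ⟧ + + m * ⟦ c ⟧
  iterate-⊕ c z zero    = ≋-reflexive (identity ⟦ z ⟧ ⟦ c ⟧)
    where identity : ∀ z c → z ≡ z + 0ℤ * c
          identity = solve-∀
  iterate-⊕ c z (suc m) = begin
    ⟦ iterate (_⊕ c) (z ⊕ c) m ⟧   ≈⟨ iterate-⊕ c (z ⊕ c) m ⟩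
    ⟦ z ⊕ c ⟧ + + m * ⟦ c ⟧        ≈⟨ +-congʳ (+ m * ⟦ c ⟧) (⟦⊕⟧ z c) ⟩
    ⟦ z ⟧ + ⟦ c ⟧ + + m * ⟦ c ⟧    ≡⟨ regroup ⟦ z ⟧ ⟦ c ⟧ (+ m) ⟩
    ⟦ z ⟧ + (1ℤ + + m) * ⟦ c ⟧     ≡⟨ cong (λ k → ⟦ z ⟧ + k * ⟦ c ⟧) (pos-+ 1 m) ⟨
    ⟦ z ⟧ + + suc m * ⟦ c ⟧        ∎
    where regroup : ∀ z c m → z + c + m * c ≡ z + (1ℤ + m) * c
          regroup = solve-∀

  iterate-⊕-surjective : ∀ c → Unit ⟦ c ⟧ → ∀ z y → ∃[ m ] iterate (_⊕ c) z m ≡ y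
  iterate-⊕-surjective c (u , cu≋1) z y
    with x , x≋u[y-z] ← ⟦⟧-surjective (u * (⟦ y ⟧ - ⟦ z ⟧)) =
    toℕ x , ⟦⟧-injective (begin
      ⟦ iterate (_⊕ c) z (toℕ x) ⟧           ≈⟨ iterate-⊕ c z (toℕ x) ⟩
      ⟦ z ⟧ + ⟦ x ⟧ * ⟦ c ⟧                  ≈⟨ +-congˡ ⟦ z ⟧ (*-congʳ ⟦ c ⟧ x≋u[y-z]) ⟩
      ⟦ z ⟧ + u * (⟦ y ⟧ - ⟦ z ⟧) * ⟦ c ⟧     ≡⟨ reassoc ⟦ y ⟧ ⟦ z ⟧ ⟦ c ⟧ u ⟩
      ⟦ z ⟧ + (⟦ y ⟧ - ⟦ z ⟧) * (⟦ c ⟧ * u)  ≈⟨ +-congˡ ⟦ z ⟧ (*-congˡ (⟦ y ⟧ - ⟦ z ⟧) cu≋1) ⟩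
      ⟦ z ⟧ + (⟦ y ⟧ - ⟦ z ⟧) * 1ℤ           ≡⟨ cancel ⟦ y ⟧ ⟦ z ⟧ ⟩
      ⟦ y ⟧                                  ∎)
    where reassoc : ∀ y z c u → z + u * (y - z) * c ≡ z + (y - z) * (c * u)
          reassoc = solve-∀
          cancel : ∀ y z → z + (y - z) * 1ℤ ≡ y
          cancel = solve-∀

  unit-translation⇒strongly-connected : ∀ {E : Fin n → Fin n → Set} c → Unit ⟦ c ⟧ →
                                         (∀ z → Star E z (z ⊕ c)) → StronglyConnected E
  unit-translation⇒strongly-connected {E} c c-unit step z y
    with m , cᵐz≡y ← iterate-⊕-surjective c c-unit z y =
    subst (Star E z) cᵐz≡y (Star-iterate (_⊕ c) step z m)

  pos-Unit : ∀ a u k {m} → n ≡ m → a ℕ.* u ≡ 1 ℕ.+ k ℕ.* m → Unit (+ a)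
  pos-Unit a u k refl au≡1+km =
    + u , (+ k , trans (sym (pos-* a u)) (trans (cong +_ au≡1+km) (pos-+-multiple 1 k)))

  coprime-to-6⇒units : n % 6 ≡ 1 ⊎ n % 6 ≡ 5 → Unit (+ 2) × Unit (+ 3)
  coprime-to-6⇒units (inj₁ n%6≡1) =
    pos-Unit 2 (3 ℕ.* q ℕ.+ 1) 1 n≡1+q*6 (two q) ,
    pos-Unit 3 (4 ℕ.* q ℕ.+ 1) 2 n≡1+q*6 (three q)
    where
    q = n ℕ./ 6
    n≡1+q*6 : n ≡ 1 ℕ.+ q ℕ.* 6
    n≡1+q*6 = trans (m≡m%n+[m/n]*n n 6) (cong (ℕ._+ q ℕ.* 6) n%6≡1)
    two : ∀ q → 2 ℕ.* (3 ℕ.* q ℕ.+ 1) ≡ 1 ℕ.+ 1 ℕ.* (1 ℕ.+ q ℕ.* 6)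
    two = ℕ-Solver.solve-∀
    three : ∀ q → 3 ℕ.* (4 ℕ.* q ℕ.+ 1) ≡ 1 ℕ.+ 2 ℕ.* (1 ℕ.+ q ℕ.* 6)
    three = ℕ-Solver.solve-∀
  coprime-to-6⇒units (inj₂ n%6≡5) =
    pos-Unit 2 (3 ℕ.* q ℕ.+ 3) 1 n≡5+q*6 (two q) ,
    pos-Unit 3 (2 ℕ.* q ℕ.+ 2) 1 n≡5+q*6 (three q)
    where
    q = n ℕ./ 6
    n≡5+q*6 : n ≡ 5 ℕ.+ q ℕ.* 6
    n≡5+q*6 = trans (m≡m%n+[m/n]*n n 6) (cong (ℕ._+ q ℕ.* 6) n%6≡5)
    two : ∀ q → 2 ℕ.* (3 ℕ.* q ℕ.+ 3) ≡ 1 ℕ.+ 1 ℕ.* (5 ℕ.+ q ℕ.* 6)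
    two = ℕ-Solver.solve-∀
    three : ∀ q → 3 ℕ.* (2 ℕ.* q ℕ.+ 2) ≡ 1 ℕ.+ 1 ℕ.* (5 ℕ.+ q ℕ.* 6)
    three = ℕ-Solver.solve-∀

module D′-Digraphs (n : ℕ) .{{_ : NonZero n}} where
  open ZMod n
  open Congruence (+ n)
  open Residues n
  open SetoidReasoning ≋-setoid

  D′-successor : Fin n → Fin n → Fin n
  D′-successor h x = neg2· (x ⊕ (⊖ h)) ⊕ h

  D′-arc : ∀ h x → D′ h x (D′-successor h x)
  D′-arc h x = x ⊕ (⊖ h) , ⟦⟧-injective (≋-sym x-h+h≋x) , refl
    where
    x-h+h≋x : ⟦ (x ⊕ (⊖ h)) ⊕ h ⟧ ≋ ⟦ x ⟧
    x-h+h≋x = begin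
      ⟦ (x ⊕ (⊖ h)) ⊕ h ⟧    ≈⟨ ⟦⊕⟧ (x ⊕ (⊖ h)) h ⟩
      ⟦ x ⊕ (⊖ h) ⟧ + ⟦ h ⟧  ≈⟨ +-congʳ ⟦ h ⟧ (⟦⊕⊖⟧ x h) ⟩
      ⟦ x ⟧ - ⟦ h ⟧ + ⟦ h ⟧  ≡⟨ cancel ⟦ x ⟧ ⟦ h ⟧ ⟩
      ⟦ x ⟧                  ∎
      where cancel : ∀ x h → x - h + h ≡ x
            cancel = solve-∀

  ⟦D′-successor⟧ : ∀ h x → ⟦ D′-successor h x ⟧ ≋ + 3 * ⟦ h ⟧ - + 2 * ⟦ x ⟧
  ⟦D′-successor⟧ h x = begin
    ⟦ neg2· (x ⊕ (⊖ h)) ⊕ h ⟧          ≈⟨ ⟦⊕⟧ (neg2· (x ⊕ (⊖ h))) h ⟩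
    ⟦ neg2· (x ⊕ (⊖ h)) ⟧ + ⟦ h ⟧      ≈⟨ +-congʳ ⟦ h ⟧ (⟦neg2·⟧ (x ⊕ (⊖ h))) ⟩
    - (+ 2 * ⟦ x ⊕ (⊖ h) ⟧) + ⟦ h ⟧    ≈⟨ +-congʳ ⟦ h ⟧ (-‿cong (*-congˡ (+ 2) (⟦⊕⊖⟧ x h))) ⟩
    - (+ 2 * (⟦ x ⟧ - ⟦ h ⟧)) + ⟦ h ⟧  ≡⟨ expand ⟦ x ⟧ ⟦ h ⟧ ⟩
    + 3 * ⟦ h ⟧ - + 2 * ⟦ x ⟧          ∎
    where expand : ∀ x h → - (+ 2 * (x - h)) + h ≡ + 3 * h - + 2 * x
          expand = solve-∀

  D′-successor-injective : Unit (+ 2) → ∀ h → Injective _≡_ _≡_ (D′-successor h)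
  D′-successor-injective 2-unit h {x} {y} Sx≡Sy =
    ⟦⟧-injective (Unit-cancelˡ {+ 2} 2-unit 2x≋2y)
    where
    -2x≋-2y : - (+ 2 * ⟦ x ⟧) ≋ - (+ 2 * ⟦ y ⟧)
    -2x≋-2y = +-cancelˡ (+ 3 * ⟦ h ⟧) (begin
      + 3 * ⟦ h ⟧ - + 2 * ⟦ x ⟧  ≈⟨ ⟦D′-successor⟧ h x ⟨
      ⟦ D′-successor h x ⟧       ≡⟨ cong ⟦_⟧ Sx≡Sy ⟩
      ⟦ D′-successor h y ⟧       ≈⟨ ⟦D′-successor⟧ h y ⟩
      + 3 * ⟦ h ⟧ - + 2 * ⟦ y ⟧  ∎)
    2x≋2y : + 2 * ⟦ x ⟧ ≋ + 2 * ⟦ y ⟧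
    2x≋2y = begin
      + 2 * ⟦ x ⟧        ≡⟨ neg-involutive (+ 2 * ⟦ x ⟧) ⟨
      - - (+ 2 * ⟦ x ⟧)  ≈⟨ -‿cong -2x≋-2y ⟩
      - - (+ 2 * ⟦ y ⟧)  ≡⟨ neg-involutive (+ 2 * ⟦ y ⟧) ⟩
      + 2 * ⟦ y ⟧        ∎

  D′-successor-⊕one : ∀ h x → D′-successor (h ⊕ one) x ≡ D′-successor h x ⊕ [ 3 ]
  D′-successor-⊕one h x = ⟦⟧-injective (begin
    ⟦ D′-successor (h ⊕ one) x ⟧      ≈⟨ ⟦D′-successor⟧ (h ⊕ one) x ⟩
    + 3 * ⟦ h ⊕ one ⟧ - + 2 * ⟦ x ⟧   ≈⟨ +-congʳ (- (+ 2 * ⟦ x ⟧)) (*-congˡ (+ 3) (⟦⊕one⟧ h)) ⟩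
    + 3 * (⟦ h ⟧ + 1ℤ) - + 2 * ⟦ x ⟧  ≡⟨ expand ⟦ h ⟧ ⟦ x ⟧ ⟩
    + 3 * ⟦ h ⟧ - + 2 * ⟦ x ⟧ + + 3   ≈⟨ +-cong (⟦D′-successor⟧ h x) (⟦[]⟧ 3) ⟨
    ⟦ D′-successor h x ⟧ + ⟦ [ 3 ] ⟧  ≈⟨ ⟦⊕⟧ (D′-successor h x) [ 3 ] ⟨
    ⟦ D′-successor h x ⊕ [ 3 ] ⟧      ∎)
    where expand : ∀ h x → + 3 * (h + 1ℤ) - + 2 * x ≡ + 3 * h - + 2 * x + + 3
          expand = solve-∀

  D′∪-reaches-translate : Unit (+ 2) → ∀ g z → Star (D′∪ g) z (z ⊕ [ 3 ])
  D′∪-reaches-translate 2-unit g z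
    with w , z↝w , w↦z ← Star-preimage (D′-successor g) (D′-successor-injective 2-unit g)
                                         (λ x → inj₁ (D′-arc g x)) z =
    z↝w ◅◅ subst (D′∪ g w) w↦z+3 (inj₂ (D′-arc (g ⊕ one) w)) ◅ ε
    where
    w↦z+3 : D′-successor (g ⊕ one) w ≡ z ⊕ [ 3 ]
    w↦z+3 = trans (D′-successor-⊕one g w) (cong (_⊕ [ 3 ]) w↦z)

lemma8 : (n : ℕ) .{{_ : NonZero n}} → (n % 6 ≡ 1 ⊎ n % 6 ≡ 5) →
    (g : Fin n) → StronglyConnected (ZMod.D′∪ n g)
lemma8 n n-coprime-to-6 g with 2-unit , 3-unit ← Residues.coprime-to-6⇒units n n-coprime-to-6 =
  unit-translation⇒strongly-connected [ 3 ] (Unit-resp-≋ (≋-sym (⟦[]⟧ 3)) 3-unit)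
    (D′-Digraphs.D′∪-reaches-translate n 2-unit g)
  where
  open ZMod n
  open Congruence (+ n)
  open Residues n
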